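{- Let $G$ be a finite simple graph with vertices $v_1,\ldots,v_n$, let $w_0$ be a weight of $G$, let $a_0=\chi(G,w_0)$, let $C_0$ be an $(\mathcal L_{a_0},w_0)$-coloring of $G$, and let $w$ be a weight of $G$ with $\vec w\ge\vec w_0$. Then $$\chi(G,w,C_0)\le a_0+\min_{\vec w'\in\vec\delta(G,\mathcal L_{a_0},C_0,w)}\chi(G,w').$$
   Context: For an integer $a\ge1$, $\mathcal L_a$ is the list assigning $\{1,\ldots,a\}$ to every vertex. A weight is a map $w:V(G)\to\mathbb N$ with weight-vector $\vec w=\sum_i w(v_i)\vec e_i\in\mathbb N^n$ (and conversely a vector $\vec w'\in\mathbb N^n$ determines a weight $w'$). For a list $L$ (finite sets $L(v)\subset\mathbb N$), an $(L,w)$-coloring is a map $C$ with $C(v)\subset L(v)$, $|C(v)|=w(v)$ and $C(v)\cap C(v')=\emptyset$ for every edge $vv'$; $\vec w(C)=\sum_i|C(v_i)|\vec e_i$. The weighted chromatic number $\chi(G,w)$ is the smallest integer $a\ge1$ such that $G$ is $(\mathcal L_a,w)$-colorable. $\vec y\le\vec x$ means coordinatewise inequality; $\min(\vec x,\vec y)$ is the coordinatewise minimum. For a coloring $C$ and $\vec d\in\mathbb N^n$, $\mathcal C^-(C,\vec d)$ is the set of maps $C'$ with $C'(v)\subset C(v)$ for all $v$ and $\vec w(C')=\vec w(C)-\vec d$. $\chi(G,w,C_0)$ is the smallest $a$ such that there exists an $(\mathcal L_a,w)$-coloring $C$ of $G$ with $C_0\in\mathcal C^-(C,\vec w-\vec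 w_0)$. For $N\subset V(G)$, $\vec N=\sum_i\lambda_i\vec e_i$ ($\lambda_i=1$ iff $v_i\in N$). For a list $L$ with $\overline L=\bigcup_vL(v)$ and a color $x$, $G^x$ is the subgraph induced by the vertices $v$ with $x\in L(v)$; $\overrightarrow{MIS}(H)=\{\vec N: N$ a maximal (w.r.t. inclusion) independent set of $H\}$; $\overrightarrow{W}_{max}(G,L)=\sum_{x\in\overline L}\overrightarrow{MIS}(G^x)$ (vectorial sum of sets). $\overrightarrow{W}_{max}(G,\mathcal L_{a_0},C_0)$ is the set of $\vec w_1\in\overrightarrow{W}_{max}(G,\mathcal L_{a_0})$ such that there is an $(\mathcal L_{a_0},w_1)$-coloring $C_1$ with $C_0\in\mathcal C^-(C_1,\vec w_1-\vec w_0)$. Finally $\vec\delta(G,\mathcal L_{a_0},C_0,w)=\{\vec w-\min(\vec w,\vec w_1):\vec w_1\in\overrightarrow{W}_{max}(G,\mathcal L_{a_0},C_0)\}$. -}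

module Defs where

open import Data.Nat using (ℕ; suc; _+_; _∸_; _⊓_; _≤_)
open import Data.Fin using (Fin; toℕ)
open import Data.Bool using (Bool; true; false; if_then_else_)
open import Data.List using (List; length; map; allFin)
open import Data.Nat.ListAction using (sum)
open import Data.List.Membership.Propositional using (_∈_)
open import Data.List.Relation.Unary.All using (All)
open import Data.List.Relation.Unary.Unique.Propositional using (Unique)
open import Data.Product using (Σ; ∃; _×_)
open import Data.Empty using (⊥)
open import Relation.Binary.PropositionalEquality using (_≡_)

record Graph (n : ℕ) : Set where
  field
    adj     : Fin n → Fin n → Bool
    adj-sym : ∀ i j → adj i j ≡ adj j i
    loopless : ∀ i → adj i i ≡ false
open Graph public

Weight : ℕ → Set
Weight n = Fin n → ℕ

-- a color assignment: each vertex gets a finite set of colors (duplicate-free list of ℕ)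
Assign : ℕ → Set
Assign n = Fin n → List ℕ

-- membership in the list L_a(v) = {1,…,a}
InLa : ℕ → ℕ → Set
InLa a x = (1 ≤ x) × (x ≤ a)

_⊆ₗ_ : List ℕ → List ℕ → Set
xs ⊆ₗ ys = ∀ {x} → x ∈ xs → x ∈ ys

IsColoring : ∀ {n} → Graph n → ℕ → Weight n → Assign n → Set
IsColoring {n} G a w C =
  (∀ v → Unique (C v)) ×
  (∀ v → All (InLa a) (C v)) ×
  (∀ v → length (C v) ≡ w v) ×
  (∀ v v' → adj G v v' ≡ true → ∀ x → x ∈ C v → x ∈ C v' → ⊥)

-- C' ∈ 𝒞⁻(C, d): C'(v) ⊂ C(v) and w(C') = w(C) − d (i.e. w(C') + d = w(C) in ℕ^n)
InCminus : ∀ {n} → Assign n → Assign n → Weight n → Set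
InCminus C' C d = ∀ v → (C' v ⊆ₗ C v) × (length (C' v) + d v ≡ length (C v))

Colorable : ∀ {n} → Graph n → ℕ → Weight n → Set
Colorable G a w = ∃ λ C → IsColoring G a w C

IsChi : ∀ {n} → Graph n → Weight n → ℕ → Set
IsChi G w a = (1 ≤ a) × Colorable G a w × (∀ b → 1 ≤ b → Colorable G b w → a ≤ b)

ColorableExt : ∀ {n} → Graph n → ℕ → Weight n → Weight n → Assign n → Set
ColorableExt G a w w0 C0 =
  ∃ λ C → IsColoring G a w C × InCminus C0 C (λ v → w v ∸ w0 v)

IsChiExt : ∀ {n} → Graph n → Weight n → Weight n → Assign n → ℕ → Set
IsChiExt G w w0 C0 a =
  (1 ≤ a) × ColorableExt G a w w0 C0 ×
  (∀ b → 1 ≤ b → ColorableExt G b w w0 C0 → a ≤ b)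

IsMISIn : ∀ {n} → Graph n → (Fin n → Set) → (Fin n → Bool) → Set
IsMISIn G S N =
  (∀ v → N v ≡ true → S v) ×
  (∀ u v → N u ≡ true → N v ≡ true → adj G u v ≡ false) ×
  (∀ v → S v → N v ≡ false → Σ _ λ u → (N u ≡ true) × (adj G u v ≡ true))

-- vertex set of G^x for the list L_a : {v : x ∈ L_a(v)}
VertG^x : ∀ {n} → ℕ → ℕ → Fin n → Set
VertG^x a x v = InLa a x

indicator : Bool → ℕ
indicator b = if b then 1 else 0

-- w⃗ ∈ W⃗_max(G, L_a) = Σ_{x ∈ {1..a}} MIS⃗(G^x): the colors x ∈ L̄_a = {1,…,a} are
-- indexed by k : Fin a via x = 1 + k
InWmax : ∀ {n} → Graph n → ℕ → Weight n → Set
InWmax {n} G a w =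
  Σ (Fin a → Fin n → Bool) λ N →
    (∀ k → IsMISIn G (VertG^x a (suc (toℕ k))) (N k)) ×
    (∀ v → w v ≡ sum (map (λ k → indicator (N k v)) (allFin a)))

InWmaxC : ∀ {n} → Graph n → ℕ → Weight n → Assign n → Weight n → Set
InWmaxC G a w0 C0 w1 =
  InWmax G a w1 ×
  (∃ λ C1 → IsColoring G a w1 C1 × InCminus C0 C1 (λ v → w1 v ∸ w0 v))

InDelta : ∀ {n} → Graph n → ℕ → Weight n → Assign n → Weight n → Weight n → Set
InDelta G a w0 C0 w d =
  ∃ λ w1 → InWmaxC G a w0 C0 w1 × (∀ v → d v ≡ w v ∸ (w v ⊓ w1 v))

-- Enlarging each colour class of C₀ to a maximal independent set of G gives a colouring C₁ with
-- weight w₁ ∈ W_max(G, L_{a₀}, C₀), so δ is non-empty. Conversely, for any such C₁ and any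
-- d = w − min(w, w₁), shrink C₁ around C₀ to a colouring with weight min(w, w₁) and colours in
-- {1,…,a₀}, then put an optimal colouring of d on top using the colours a₀+1,…,a₀+χ(G,d):
-- this is an (L_{a₀+χ(G,d)}, w)-colouring extending C₀, whence χ(G,w,C₀) ≤ a₀ + χ(G,d).
module Submission where

open import Defs
open import Level using (Level)
open import Data.Nat using (ℕ; zero; suc; _+_; _∸_; _⊓_; _≤_; z≤n; s≤s)
open import Data.Nat.Properties
import Data.Nat as ℕ
open import Data.Fin using (Fin; toℕ; fromℕ<) renaming (_≟_ to _≟ᶠ_)
open import Data.Fin.Properties using (toℕ<n; toℕ-injective; toℕ-fromℕ<; any?)
open import Data.Bool using (Bool; true; false)
open import Data.Bool.Properties using (¬-not; not-¬) renaming (_≟_ to _≟ᵇ_)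
open import Data.List using (List; []; _∷_; length; map; allFin; filter; _++_)
open import Data.List.Properties using (length-++; length-map; filter-notAll)
open import Data.Nat.ListAction using (sum)
open import Data.List.Membership.Propositional using (_∈_; find)
open import Data.List.Membership.Propositional.Properties
  using (∈-map⁻; ∈-map⁺; ∈-++⁻; ∈-++⁺ˡ; ∈-filter⁻; ∈-filter⁺; ∈-allFin)
open import Data.List.Relation.Binary.Subset.Propositional using (_⊆_)
open import Data.List.Relation.Unary.All as All using (All; _∷_)
import Data.List.Relation.Unary.All.Properties as All
open import Data.List.Relation.Unary.Any as Any using (here; there)
open import Data.List.Relation.Unary.Unique.Propositional using (Unique; _∷_)
import Data.List.Relation.Unary.Unique.Propositional.Properties as Unique
open import Data.Product using (∃; _×_; _,_; proj₁; proj₂)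
open import Data.Sum using (_⊎_; inj₁; inj₂)
open import Data.Empty using (⊥; ⊥-elim)
open import Data.List.Membership.DecPropositional ℕ._≟_ using () renaming (_∈?_ to _∈ℕ?_)
open import Function using (_∘_)
open import Relation.Nullary using (Dec; ¬_; yes; no; does; ¬?)
open import Relation.Nullary.Decidable using (decidable-stable; dec-true; _×-dec_)
open import Relation.Binary.Definitions using (DecidableEquality)
open import Relation.Binary.PropositionalEquality

module _ {ℓ : Level} {A : Set ℓ} (_≟_ : DecidableEquality A) where

  open import Data.List.Membership.DecPropositional _≟_ using (_∈?_; _∉?_)

  Unique-⊆⇒length-≤ : ∀ {xs ys : List A} → Unique xs → xs ⊆ ys → length xs ≤ length ys
  Unique-⊆⇒length-≤ {[]}     _               _     = z≤n
  Unique-⊆⇒length-≤ {x ∷ xs} {ys} (x∉xs ∷ uxs) x∷xs⊆ys =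
    ≤-<-trans (Unique-⊆⇒length-≤ uxs xs⊆ys-x) (filter-notAll (λ y → ¬? (x ≟ y)) ys x∈ys)
    where
    xs⊆ys-x : xs ⊆ filter (λ y → ¬? (x ≟ y)) ys
    xs⊆ys-x z∈xs = ∈-filter⁺ _ (x∷xs⊆ys (there z∈xs)) (All.lookup x∉xs z∈xs)
    x∈ys : Any.Any (λ y → ¬ x ≢ y) ys
    x∈ys = Any.map (λ x≡y x≢y → x≢y x≡y) (x∷xs⊆ys (here refl))

  extend-by : ∀ k {xs ys : List A} → Unique xs → Unique ys → xs ⊆ ys → length xs + k ≤ length ys →
    ∃ λ zs → Unique zs × xs ⊆ zs × zs ⊆ ys × length zs ≡ length xs + k
  extend-by zero {xs} uxs _ xs⊆ys _ = xs , uxs , (λ p → p) , xs⊆ys , sym (+-identityʳ _)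
  extend-by (suc k) {xs} {ys} uxs uys xs⊆ys len with Any.any? (_∉? xs) ys
  ... | no ¬ys⊈xs = ⊥-elim (<⇒≱ (subst (_≤ length ys) (+-suc (length xs) k) len)
                                 (≤-trans (Unique-⊆⇒length-≤ uys ys⊆xs) (m≤m+n _ k)))
    where
    ys⊆xs : ys ⊆ xs
    ys⊆xs {y} y∈ys = decidable-stable (y ∈? xs) (λ y∉xs → ¬ys⊈xs (Any.map (λ { refl → y∉xs }) y∈ys))
  ... | yes ys⊈xs
    with y , y∈ys , y∉xs ← find ys⊈xs
    with zs , uzs , y∷xs⊆zs , zs⊆ys , |zs| ←
         extend-by k (All.tabulate (λ { z∈xs refl → y∉xs z∈xs }) ∷ uxs) uys
                     (λ { (here refl) → y∈ys ; (there p) → xs⊆ys p })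
                     (subst (_≤ length ys) (+-suc (length xs) k) len)
    = zs , uzs , y∷xs⊆zs ∘ there , zs⊆ys , trans |zs| (sym (+-suc (length xs) k))

  extend-within : ∀ {xs ys : List A} → Unique xs → Unique ys → xs ⊆ ys →
    ∀ m → length xs ≤ m → m ≤ length ys →
    ∃ λ zs → Unique zs × xs ⊆ zs × zs ⊆ ys × length zs ≡ m
  extend-within {xs} {ys} uxs uys xs⊆ys m xs≤m m≤ys
    with zs , uzs , xs⊆zs , zs⊆ys , |zs| ← extend-by (m ∸ length xs) uxs uys xs⊆ys
           (subst (_≤ length ys) (sym (m+[n∸m]≡n xs≤m)) m≤ys)
    = zs , uzs , xs⊆zs , zs⊆ys , trans |zs| (m+[n∸m]≡n xs≤m)

length-filter-≡true : ∀ {ℓ} {A : Set ℓ} (f : A → Bool) xs →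
  length (filter (λ x → f x ≟ᵇ true) xs) ≡ sum (map (indicator ∘ f) xs)
length-filter-≡true f [] = refl
length-filter-≡true f (x ∷ xs) with f x
... | true  = cong suc (length-filter-≡true f xs)
... | false = length-filter-≡true f xs

color : ∀ {a} → Fin a → ℕ
color k = suc (toℕ k)

color-injective : ∀ {a} {k k′ : Fin a} → color k ≡ color k′ → k ≡ k′
color-injective = toℕ-injective ∘ suc-injective

color-InLa : ∀ {a} (k : Fin a) → InLa a (color k)
color-InLa k = s≤s z≤n , toℕ<n k

InLa⇒color : ∀ {a x} → InLa a x → ∃ λ (k : Fin a) → color k ≡ x
InLa⇒color {x = suc x} (_ , x<a) = fromℕ< x<a , cong suc (toℕ-fromℕ< x<a)

_⊆ᵇ_ : ∀ {n} → (Fin n → Bool) → (Fin n → Bool) → Set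
N ⊆ᵇ M = ∀ v → N v ≡ true → M v ≡ true

does-true⇒ : ∀ {p} {P : Set p} (p? : Dec P) → does p? ≡ true → P
does-true⇒ (yes p) _ = p

colorClass : ∀ {n} → Assign n → ℕ → Fin n → Bool
colorClass C x v = does (x ∈ℕ? C v)

classes : ∀ {n a} → (Fin a → Fin n → Bool) → Assign n
classes {a = a} N v = map color (filter (λ k → N k v ≟ᵇ true) (allFin a))

classWeight : ∀ {n a} → (Fin a → Fin n → Bool) → Weight n
classWeight {a = a} N v = sum (map (λ k → indicator (N k v)) (allFin a))

∈-classes⁺ : ∀ {n a} {N : Fin a → Fin n → Bool} {k v} → N k v ≡ true → color k ∈ classes N v
∈-classes⁺ Nkv = ∈-map⁺ color (∈-filter⁺ _ (∈-allFin _) Nkv)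

stack : ∀ {n} → ℕ → Assign n → Assign n → Assign n
stack a X D v = X v ++ map (a +_) (D v)

module _ {n} (G : Graph n) where

  Independent : (Fin n → Bool) → Set
  Independent N = ∀ u v → N u ≡ true → N v ≡ true → adj G u v ≡ false

  Dominated : (Fin n → Bool) → Fin n → Set
  Dominated N v = N v ≡ true ⊎ ∃ λ u → N u ≡ true × adj G u v ≡ true

  insert : Fin n → (Fin n → Bool) → Fin n → Bool
  insert v N u with u ≟ᶠ v
  ... | yes _ = true
  ... | no  _ = N u

  insert-∈ : ∀ v N → insert v N v ≡ true
  insert-∈ v N with v ≟ᶠ v
  ... | yes _   = refl
  ... | no v≢v = ⊥-elim (v≢v refl)

  ⊆ᵇ-insert : ∀ v N → N ⊆ᵇ insert v N
  ⊆ᵇ-insert v N u Nu with u ≟ᶠ v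
  ... | yes _ = refl
  ... | no  _ = Nu

  insert⁻ : ∀ v N u → insert v N u ≡ true → u ≡ v ⊎ N u ≡ true
  insert⁻ v N u with u ≟ᶠ v
  ... | yes u≡v = λ _ → inj₁ u≡v
  ... | no  _   = inj₂

  insert-independent : ∀ {N} v → Independent N → (∀ u → N u ≡ true → adj G u v ≡ false) →
    Independent (insert v N)
  insert-independent {N} v indN v-isolated u u′ u∈ u′∈ = go (insert⁻ v N u u∈) (insert⁻ v N u′ u′∈)
    where
    go : u ≡ v ⊎ N u ≡ true → u′ ≡ v ⊎ N u′ ≡ true → adj G u u′ ≡ false
    go (inj₁ refl) (inj₁ refl) = loopless G u
    go (inj₁ refl) (inj₂ Nu′)  = trans (adj-sym G u u′) (v-isolated u′ Nu′)
    go (inj₂ Nu)   (inj₁ refl) = v-isolated u Nu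
    go (inj₂ Nu)   (inj₂ Nu′)  = indN u u′ Nu Nu′

  dominate : ∀ N → Independent N → ∀ v → ∃ λ M → Independent M × N ⊆ᵇ M × Dominated M v
  dominate N indN v with any? (λ u → (N u ≟ᵇ true) ×-dec (adj G u v ≟ᵇ true))
  ... | yes (u , Nu , uv) = N , indN , (λ _ p → p) , inj₂ (u , Nu , uv)
  ... | no ¬neighbour =
    insert v N , insert-independent v indN (λ u Nu → ¬-not (λ uv → ¬neighbour (u , Nu , uv))) ,
    ⊆ᵇ-insert v N , inj₁ (insert-∈ v N)

  dominate-all : ∀ (vs : List (Fin n)) N → Independent N →
    ∃ λ M → Independent M × N ⊆ᵇ M × (∀ {v} → v ∈ vs → Dominated M v)
  dominate-all [] N indN = N , indN , (λ _ p → p) , λ ()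
  dominate-all (v ∷ vs) N indN
    with M , indM , N⊆M , v-dom ← dominate N indN v
    with K , indK , M⊆K , vs-dom ← dominate-all vs M indM
    = K , indK , (λ u → M⊆K u ∘ N⊆M u) , λ { (here refl) → ⊆ᵇ-dominated M⊆K v-dom ; (there p) → vs-dom p }
    where
    ⊆ᵇ-dominated : ∀ {M K u} → M ⊆ᵇ K → Dominated M u → Dominated K u
    ⊆ᵇ-dominated M⊆K (inj₁ Mu)             = inj₁ (M⊆K _ Mu)
    ⊆ᵇ-dominated M⊆K (inj₂ (u , Mu , adj)) = inj₂ (u , M⊆K u Mu , adj)

  maximal-independent-superset : ∀ S → Independent S →
    ∃ λ M → Independent M × S ⊆ᵇ M × (∀ v → Dominated M v)
  maximal-independent-superset S indS
    with M , indM , S⊆M , dom ← dominate-all (allFin n) S indS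
    = M , indM , S⊆M , λ v → dom (∈-allFin v)

  dominating⇒IsMISIn : ∀ {S N} → (∀ v → N v ≡ true → S v) → Independent N →
    (∀ v → Dominated N v) → IsMISIn G S N
  dominating⇒IsMISIn {S} {N} N⊆S indN dom = N⊆S , indN , maximal
    where
    maximal : ∀ v → S v → N v ≡ false → ∃ λ u → N u ≡ true × adj G u v ≡ true
    maximal v _ Nv≡false with dom v
    ... | inj₁ Nv≡true   = ⊥-elim (not-¬ Nv≡true Nv≡false)
    ... | inj₂ neighbour = neighbour

  IsColoring-resp-≗ : ∀ {a w w′ C} → (∀ v → w v ≡ w′ v) → IsColoring G a w C → IsColoring G a w′ C
  IsColoring-resp-≗ w≗w′ (uC , rC , lC , pC) = uC , rC , (λ v → trans (lC v) (w≗w′ v)) , pC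

  ⊆⇒weight-≤ : ∀ {a b w′ w C′ C} → IsColoring G a w′ C′ → IsColoring G b w C →
    (∀ v → C′ v ⊆ C v) → ∀ v → w′ v ≤ w v
  ⊆⇒weight-≤ (uC′ , _ , lC′ , _) (_ , _ , lC , _) C′⊆C v =
    subst₂ _≤_ (lC′ v) (lC v) (Unique-⊆⇒length-≤ ℕ._≟_ (uC′ v) (C′⊆C v))

  ⊆⇒InCminus : ∀ {a b w′ w C′ C} → IsColoring G a w′ C′ → IsColoring G b w C →
    (∀ v → C′ v ⊆ C v) → InCminus C′ C (λ v → w v ∸ w′ v)
  ⊆⇒InCminus {w′ = w′} {w} {C′} {C} col′ col C′⊆C v = C′⊆C v , (begin
    length (C′ v) + (w v ∸ w′ v) ≡⟨ cong (_+ (w v ∸ w′ v)) (proj₁ (proj₂ (proj₂ col′)) v) ⟩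
    w′ v + (w v ∸ w′ v)          ≡⟨ m+[n∸m]≡n (⊆⇒weight-≤ col′ col C′⊆C v) ⟩
    w v                          ≡⟨ sym (proj₁ (proj₂ (proj₂ col)) v) ⟩
    length (C v)                 ∎)
    where open ≡-Reasoning

  IsColoring-between : ∀ {a w′ w C′ C} → IsColoring G a w′ C′ → IsColoring G a w C →
    (∀ v → C′ v ⊆ C v) → ∀ m → (∀ v → w′ v ≤ m v) → (∀ v → m v ≤ w v) →
    ∃ λ X → IsColoring G a m X × (∀ v → C′ v ⊆ X v)
  IsColoring-between {a} {C′ = C′} {C} (uC′ , _ , lC′ , _) (uC , rC , lC , pC) C′⊆C m w′≤m m≤w =
    X , (uX , rX , lX , pX) , λ v → proj₁ (proj₂ (proj₂ (between v)))
    where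
    between : ∀ v → ∃ λ X → Unique X × C′ v ⊆ X × X ⊆ C v × length X ≡ m v
    between v = extend-within ℕ._≟_ (uC′ v) (uC v) (C′⊆C v) (m v)
      (subst (_≤ m v) (sym (lC′ v)) (w′≤m v)) (subst (m v ≤_) (sym (lC v)) (m≤w v))
    X : Assign n
    X v = proj₁ (between v)
    X⊆C : ∀ v → X v ⊆ C v
    X⊆C v = proj₁ (proj₂ (proj₂ (proj₂ (between v))))
    uX : ∀ v → Unique (X v)
    uX v = proj₁ (proj₂ (between v))
    rX : ∀ v → All (InLa a) (X v)
    rX v = All.anti-mono (X⊆C v) (rC v)
    lX : ∀ v → length (X v) ≡ m v
    lX v = proj₂ (proj₂ (proj₂ (proj₂ (between v))))
    pX : ∀ v v′ → adj G v v′ ≡ true → ∀ x → x ∈ X v → x ∈ X v′ → ⊥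
    pX v v′ vv′ x x∈Xv x∈Xv′ = pC v v′ vv′ x (X⊆C v x∈Xv) (X⊆C v′ x∈Xv′)

  colorClass-independent : ∀ {a w C} → IsColoring G a w C → ∀ x → Independent (colorClass C x)
  colorClass-independent (_ , _ , _ , proper) x u v x∈Cu x∈Cv =
    ¬-not (λ uv → proper u v uv x (does-true⇒ (x ∈ℕ? _) x∈Cu) (does-true⇒ (x ∈ℕ? _) x∈Cv))

  classes-isColoring : ∀ {a} {N : Fin a → Fin n → Bool} → (∀ k → Independent (N k)) →
    IsColoring G a (classWeight N) (classes N)
  classes-isColoring {a} {N} indN = uC , rC , lC , pC
    where
    members : ∀ v → List (Fin a)
    members v = filter (λ k → N k v ≟ᵇ true) (allFin a)
    uC : ∀ v → Unique (classes N v)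
    uC v = Unique.map⁺ color-injective (Unique.filter⁺ _ (Unique.allFin⁺ a))
    rC : ∀ v → All (InLa a) (classes N v)
    rC v = All.map⁺ (All.universal color-InLa (members v))
    lC : ∀ v → length (classes N v) ≡ classWeight N v
    lC v = trans (length-map color (members v)) (length-filter-≡true (λ k → N k v) (allFin a))
    pC : ∀ v v′ → adj G v v′ ≡ true → ∀ x → x ∈ classes N v → x ∈ classes N v′ → ⊥
    pC v v′ vv′ x x∈Cv x∈Cv′
      with k , k∈ , refl ← ∈-map⁻ color x∈Cv
      with k′ , k′∈ , ck≡ck′ ← ∈-map⁻ color x∈Cv′
      with refl ← color-injective ck≡ck′
      = not-¬ vv′ (indN k v v′ (proj₂ (∈-filter⁻ (λ k → N k v ≟ᵇ true) {xs = allFin a} k∈))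
        (proj₂ (∈-filter⁻ (λ k → N k v′ ≟ᵇ true) {xs = allFin a} k′∈)))

  stack-isColoring : ∀ {a b m d X D} → IsColoring G a m X → IsColoring G b d D →
    IsColoring G (a + b) (λ v → m v + d v) (stack a X D)
  stack-isColoring {a} {b} {m} {d} {X} {D} (uX , rX , lX , pX) (uD , rD , lD , pD) = uC , rC , lC , pC
    where
    separated : ∀ {v v′ x} → x ∈ X v → x ∈ map (a +_) (D v′) → ⊥
    separated {v} x∈Xv x∈D+a with y , y∈ , refl ← ∈-map⁻ (a +_) x∈D+a =
      <⇒≱ (m<m+n a (proj₁ (All.lookup (rD _) y∈))) (proj₂ (All.lookup (rX v) x∈Xv))
    uC : ∀ v → Unique (stack a X D v)
    uC v = Unique.++⁺ (uX v) (Unique.map⁺ (+-cancelˡ-≡ a _ _) (uD v)) λ (p , q) → separated p q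
    rC : ∀ v → All (InLa (a + b)) (stack a X D v)
    rC v = All.++⁺ (All.map (λ (1≤x , x≤a) → 1≤x , ≤-trans x≤a (m≤m+n a b)) (rX v))
                   (All.map⁺ (All.map (λ (1≤y , y≤b) → ≤-trans 1≤y (m≤n+m _ a) , +-monoʳ-≤ a y≤b) (rD v)))
    lC : ∀ v → length (stack a X D v) ≡ m v + d v
    lC v = begin
      length (X v ++ map (a +_) (D v))        ≡⟨ length-++ (X v) ⟩
      length (X v) + length (map (a +_) (D v)) ≡⟨ cong₂ _+_ (lX v) (trans (length-map (a +_) (D v)) (lD v)) ⟩
      m v + d v                               ∎
      where open ≡-Reasoning
    pC : ∀ v v′ → adj G v v′ ≡ true → ∀ x → x ∈ stack a X D v → x ∈ stack a X D v′ → ⊥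
    pC v v′ vv′ x x∈Cv x∈Cv′ with ∈-++⁻ (X v) x∈Cv | ∈-++⁻ (X v′) x∈Cv′
    ... | inj₁ p | inj₁ q = pX v v′ vv′ x p q
    ... | inj₁ p | inj₂ q = separated p q
    ... | inj₂ p | inj₁ q = separated q p
    ... | inj₂ p | inj₂ q
      with y , y∈ , refl ← ∈-map⁻ (a +_) p
      with y′ , y′∈ , a+y≡a+y′ ← ∈-map⁻ (a +_) q
      with refl ← +-cancelˡ-≡ a y y′ a+y≡a+y′
      = pD v v′ vv′ y y∈ y′∈

InWmaxC-inhabited : ∀ {n} (G : Graph n) {a w0 C0} → IsColoring G a w0 C0 → ∃ (InWmaxC G a w0 C0)
InWmaxC-inhabited G {a} {w0} {C0} col0 =
  classWeight N , (N , N-maximal , λ _ → refl) , classes N , col1 , ⊆⇒InCminus G col0 col1 C0⊆C1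
  where
  extension : (k : Fin a) →
    ∃ λ M → Independent G M × colorClass C0 (color k) ⊆ᵇ M × (∀ v → Dominated G M v)
  extension k = maximal-independent-superset G _ (colorClass-independent G col0 (color k))
  N : Fin a → Fin _ → Bool
  N k = proj₁ (extension k)
  N-maximal : ∀ k → IsMISIn G (VertG^x a (color k)) (N k)
  N-maximal k = dominating⇒IsMISIn G (λ _ _ → color-InLa k)
    (proj₁ (proj₂ (extension k))) (proj₂ (proj₂ (proj₂ (extension k))))
  col1 : IsColoring G a (classWeight N) (classes N)
  col1 = classes-isColoring G (λ k → proj₁ (proj₂ (extension k)))
  C0⊆C1 : ∀ v → C0 v ⊆ classes N v
  C0⊆C1 v {x} x∈C0v with k , refl ← InLa⇒color (All.lookup (proj₁ (proj₂ col0) v) x∈C0v) =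
    ∈-classes⁺ {N = N} (proj₁ (proj₂ (proj₂ (extension k))) v (dec-true (color k ∈ℕ? C0 v) x∈C0v))

ColorableExt-stack : ∀ {n} (G : Graph n) {a0 b w0 w w1 d C0 C1 D} →
  IsColoring G a0 w0 C0 → (∀ v → w0 v ≤ w v) →
  IsColoring G a0 w1 C1 → (∀ v → C0 v ⊆ C1 v) →
  IsColoring G b d D → (∀ v → d v ≡ w v ∸ (w v ⊓ w1 v)) →
  ColorableExt G (a0 + b) w w0 C0
ColorableExt-stack G {a0} {b} {w = w} {w1} {D = D} col0 w0≤w col1 C0⊆C1 colD d≡
  with X , colX , C0⊆X ← IsColoring-between G col0 col1 C0⊆C1 (λ v → w v ⊓ w1 v)
         (λ v → ⊓-glb (w0≤w v) (⊆⇒weight-≤ G col0 col1 C0⊆C1 v)) (λ v → m⊓n≤n (w v) (w1 v))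
  = _ , colC , ⊆⇒InCminus G col0 colC (λ v → ∈-++⁺ˡ ∘ C0⊆X v)
  where
  colC : IsColoring G (a0 + b) w (stack a0 X D)
  colC = IsColoring-resp-≗ G
    (λ v → trans (cong (w v ⊓ w1 v +_) (d≡ v)) (m+[n∸m]≡n (m⊓n≤m (w v) (w1 v))))
    (stack-isColoring G colX colD)

theorem7p1 : ∀ {n} (G : Graph n) (w0 : Weight n) (a0 : ℕ) → IsChi G w0 a0 →
    (C0 : Assign n) → IsColoring G a0 w0 C0 →
    (w : Weight n) → (∀ v → w0 v ≤ w v) →
    ∀ c → IsChiExt G w w0 C0 c →
    (∃ λ d → InDelta G a0 w0 C0 w d) ×
    (∀ d → InDelta G a0 w0 C0 w d → ∀ b → IsChi G d b → c ≤ a0 + b)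
theorem7p1 G w0 a0 (1≤a0 , _) C0 col0 w w0≤w c (_ , _ , c-least) = δ-inhabited , c≤a0+χ
  where
  δ-inhabited : ∃ λ d → InDelta G a0 w0 C0 w d
  δ-inhabited with w1 , w1∈Wmax ← InWmaxC-inhabited G col0 = _ , w1 , w1∈Wmax , λ _ → refl
  c≤a0+χ : ∀ d → InDelta G a0 w0 C0 w d → ∀ b → IsChi G d b → c ≤ a0 + b
  c≤a0+χ d (w1 , (_ , C1 , col1 , C0∈C⁻C1) , d≡) b (_ , (D , colD) , _) =
    c-least (a0 + b) (≤-trans 1≤a0 (m≤m+n a0 b))
      (ColorableExt-stack G col0 w0≤w col1 (proj₁ ∘ C0∈C⁻C1) colD d≡)
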